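{- Let $G$ be an abelian group of order $2^r$ for some $r>0$, and let $M$ be a finite $\mathbb{F}_2[G]$-module. Writing $N_G:=\sum_{g\in G}g\in\mathbb{F}_2[G]$, \[\dim_{\mathbb{F}_2}M\leq(2^r-1)\dim_{\mathbb{F}_2}M^G+\dim_{\mathbb{F}_2}(N_G\cdot M).\]
   Context: $M^G$ denotes the subspace of $G$-fixed elements of $M$. -}

module Defs where

open import Data.Nat using (ℕ)
open import Data.Fin using (Fin)
open import Data.Fin.Properties using (_≟_; any?; all?)
open import Data.List using (List; length; filter; foldr; map)
open import Data.List.Base using (allFin)
open import Data.Product using (Σ; _×_; _,_; ∃)
open import Relation.Binary.PropositionalEquality using (_≡_)
open import Algebra.Structures using (IsAbelianGroup)

-- A finite abelian group of order n, realised on the carrier Fin n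
-- (every finite abelian group of order n is isomorphic to one of these).
record FinAbGroup (n : ℕ) : Set where
  field
    _∙_ : Fin n → Fin n → Fin n
    ε   : Fin n
    _⁻¹ : Fin n → Fin n
    isAbelianGroup : IsAbelianGroup _≡_ _∙_ ε _⁻¹

-- A finite F₂[G]-module on the carrier Fin m: an abelian group in which
-- x + x = 0 (i.e. an F₂-vector space; the F₂-scalar multiplication is forced),
-- together with a G-action by additive (= F₂-linear) maps.  Such data is
-- exactly an F₂[G]-module structure (extend the action linearly to F₂[G]).
record FinF2GModule {n : ℕ} (G : FinAbGroup n) (m : ℕ) : Set where
  open FinAbGroup G
  field
    _+_ : Fin m → Fin m → Fin m
    0#  : Fin m
    -_  : Fin m → Fin m
    isAbelianGroup : IsAbelianGroup _≡_ _+_ 0# -_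
    char2 : ∀ x → x + x ≡ 0#
    act : Fin n → Fin m → Fin m
    act-ε : ∀ x → act ε x ≡ x
    act-∙ : ∀ g h x → act (g ∙ h) x ≡ act g (act h x)
    act-+ : ∀ g x y → act g (x + y) ≡ act g x + act g y

  norm : Fin m → Fin m
  norm x = foldr (λ g acc → act g x + acc) 0# (allFin n)

  Fixed : Fin m → Set
  Fixed x = ∀ g → act g x ≡ x

  InNormImage : Fin m → Set
  InNormImage y = ∃ λ x → norm x ≡ y

  cardFixed : ℕ
  cardFixed = length (filter (λ x → all? (λ g → act g x ≟ x)) (allFin m))

  cardNormImage : ℕ
  cardNormImage = length (filter (λ y → any? (λ x → norm x ≟ y)) (allFin m))

-- Adjoin to the trivial subgroup, one at a time, elements g ∉ H with g² ∈ H; such a g exists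
-- while H ≠ G, by repeatedly squaring any element outside H, since every element has 2-power
-- order. This gives a chain 1 = H₀ < H₁ < ⋯ < Hᵣ = G with [Hᵢ₊₁ : Hᵢ] = 2. For H′ = H ∪ gH
-- let τ = 1 + g ∈ 𝔽₂[G], so that N_H′ = τ N_H. Because g² ∈ H, τ maps M^H into M^H′, and on
-- M^H its kernel is M^H′; likewise τ maps N_H M onto N_H′ M with kernel inside M^H′. Counting
-- fibres gives |M^H| ≤ |M^H′|² and |N_H M| ≤ |M^H′| |N_H′ M|, so the bound
-- |M| ≤ |M^H|^(|H| - 1) |N_H M|, trivial for H = 1, propagates up the chain to H = G.
-- Taking log₂ gives the theorem.
module Submission where

open import Defs
open import Data.Nat using (ℕ; suc; _^_; _∸_; _*_; _+_; _≤_)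
open import Relation.Binary.PropositionalEquality using (_≡_)
open import Data.Nat using (zero; pred; _<_; z≤n; s≤s)
import Data.Nat.Properties as ℕ
open import Data.Nat.Logarithm using (⌊log₂⌋-mono-≤; ⌊log₂[2^n]⌋≡n)
open import Data.Nat.Solver using (module +-*-Solver)
open import Data.Bool using (Bool; true; false; _∨_; if_then_else_)
open import Data.Bool.Properties using (∨-zeroʳ; ⇔→≡; ¬-not) renaming (_≟_ to _≟ᵇ_)
open import Data.Fin using (Fin; zero; suc)
open import Data.Fin.Properties using (_≟_; all?; any?; ¬∀⟶∃¬; nonZeroIndex; suc-injective)
open import Data.Fin.Permutation using (Permutation′; permutation)
open import Data.List using (List; []; _∷_; length; map; filter; foldr; allFin; tabulate; cartesianProduct)
open import Data.List.Properties using (length-++; length-map; length-removeAt′; length-tabulate; filter-all; filter-≐)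
import Data.List.Relation.Unary.All as All
open import Data.Product using (∃-syntax; _×_; _,_; proj₁; proj₂)
open import Data.Sum using (_⊎_; inj₁; inj₂)
open import Data.Empty using (⊥; ⊥-elim)
open import Function using (_∘_; id; mk⇔; Injective)
open import Algebra.Bundles using (AbelianGroup; CommutativeMonoid; module Group)
open import Algebra.Core using (Op₂)
open import Algebra.Definitions using (RightCancellative)
open import Algebra.Structures using (IsCommutativeMonoid)
import Algebra.Properties.AbelianGroup
import Algebra.Properties.CommutativeMonoid.Mult
import Algebra.Properties.CommutativeMonoid.Sum
import Algebra.Properties.CommutativeSemigroup
open import Level using (0ℓ)
open import Relation.Binary.PropositionalEquality using (_≢_; refl; sym; trans; cong; cong₂; subst; subst₂; module ≡-Reasoning)
open import Relation.Nullary using (¬_; does; yes; no; contradiction)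
open import Relation.Nullary.Decidable using (dec-true; dec-false; _×-dec_; _→-dec_)
open import Relation.Unary using (Pred; Decidable; _⟨×⟩_; _≐_)

module Counting where

  open import Data.List.Membership.Propositional using (_∈_)
  open import Data.List.Membership.Propositional.Properties
    using (∈-map⁻; ∈-filter⁺; ∈-filter⁻; ∈-allFin; ∈-cartesianProduct⁺)
  open import Data.List.Relation.Binary.Subset.Propositional using (_⊆_)
  open import Data.List.Relation.Unary.Any using (here; there; index; _─_)
  open import Data.List.Relation.Unary.AllPairs using (_∷_)
  open import Data.List.Relation.Unary.Unique.Propositional using (Unique)
  open import Data.List.Relation.Unary.Unique.Propositional.Properties using (map⁺; filter⁺; allFin⁺)

  module _ {A : Set} where

    ∈-─⁺ : ∀ {x y : A} {ys} (y∈ys : y ∈ ys) → x ∈ ys → x ≢ y → x ∈ (ys ─ y∈ys)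
    ∈-─⁺ (here refl)  (here refl)  x≢y = ⊥-elim (x≢y refl)
    ∈-─⁺ (here refl)  (there x∈ys) x≢y = x∈ys
    ∈-─⁺ (there y∈ys) (here refl)  x≢y = here refl
    ∈-─⁺ (there y∈ys) (there x∈ys) x≢y = there (∈-─⁺ y∈ys x∈ys x≢y)

    Unique-⊆⇒length-≤ : ∀ {xs ys : List A} → Unique xs → xs ⊆ ys → length xs ≤ length ys
    Unique-⊆⇒length-≤ {[]}     _                   _     = z≤n
    Unique-⊆⇒length-≤ {x ∷ xs} {ys} (x∉xs ∷ xs!) xs⊆ys = begin
      suc (length xs)          ≤⟨ s≤s (Unique-⊆⇒length-≤ xs! xs⊆ys─x) ⟩
      suc (length (ys ─ x∈ys)) ≡⟨ sym (length-removeAt′ ys (index x∈ys)) ⟩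
      length ys                ∎
      where
      open ℕ.≤-Reasoning
      x∈ys : x ∈ ys
      x∈ys = xs⊆ys (here refl)
      xs⊆ys─x : xs ⊆ (ys ─ x∈ys)
      xs⊆ys─x z∈xs = ∈-─⁺ x∈ys (xs⊆ys (there z∈xs)) (All.lookup x∉xs z∈xs ∘ sym)

  length-cartesianProduct : ∀ {A B : Set} (xs : List A) (ys : List B) →
                            length (cartesianProduct xs ys) ≡ length xs * length ys
  length-cartesianProduct []       ys = refl
  length-cartesianProduct (x ∷ xs) ys = trans (length-++ (map (x ,_) ys))
    (cong₂ _+_ (length-map (x ,_) ys) (length-cartesianProduct xs ys))

  card : ∀ {k} {P : Pred (Fin k) 0ℓ} → Decidable P → ℕ
  card {k} P? = length (filter P? (allFin k))

  card-≐ : ∀ {k} {P Q : Pred (Fin k) 0ℓ} (P? : Decidable P) (Q? : Decidable Q) → P ≐ Q → card P? ≡ card Q?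
  card-≐ {k} P? Q? P≐Q = cong length (filter-≐ P? Q? P≐Q (allFin k))

  card-universal : ∀ {k} {P : Pred (Fin k) 0ℓ} (P? : Decidable P) → (∀ x → P x) → card P? ≡ k
  card-universal {k} P? universal =
    trans (cong length (filter-all P? (All.universal universal (allFin k)))) (length-tabulate id)

  card-≤-* : ∀ {a b c} {P : Pred (Fin a) 0ℓ} {Q : Pred (Fin b) 0ℓ} {R : Pred (Fin c) 0ℓ}
             (P? : Decidable P) (Q? : Decidable Q) (R? : Decidable R)
             (φ : Fin a → Fin b × Fin c) → Injective _≡_ _≡_ φ →
             (∀ {x} → P x → (Q ⟨×⟩ R) (φ x)) →
             card P? ≤ card Q? * card R?
  card-≤-* {a} {b} {c} P? Q? R? φ φ-injective φ-maps = begin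
    card P?                               ≡⟨ sym (length-map φ Ps) ⟩
    length (map φ Ps)                     ≤⟨ Unique-⊆⇒length-≤ (map⁺ φ-injective (filter⁺ P? (allFin⁺ a))) image⊆ ⟩
    length (cartesianProduct Qs Rs)       ≡⟨ length-cartesianProduct Qs Rs ⟩
    card Q? * card R?                     ∎
    where
    open ℕ.≤-Reasoning
    Ps : List (Fin a)
    Ps = filter P? (allFin a)
    Qs : List (Fin b)
    Qs = filter Q? (allFin b)
    Rs : List (Fin c)
    Rs = filter R? (allFin c)
    image⊆ : map φ Ps ⊆ cartesianProduct Qs Rs
    image⊆ y∈image with x , x∈Ps , refl ← ∈-map⁻ φ y∈image =
      let (Qφx , Rφx) = φ-maps (proj₂ (∈-filter⁻ P? {xs = allFin a} x∈Ps)) in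
      ∈-cartesianProduct⁺ (∈-filter⁺ Q? (∈-allFin _) Qφx) (∈-filter⁺ R? (∈-allFin _) Rφx)

  -- Read x + y as x − y (the two agree in characteristic 2): the fibres of τ on P then lie in
  -- translates of K, and x ↦ (x − s (τ x) , τ x), for a section s of τ on P, is injective.
  module _ {m} {_+_ : Op₂ (Fin m)} (+-cancelʳ : RightCancellative _≡_ _+_) (τ : Fin m → Fin m) where

    card-≤-kernel*image : ∀ {P K I : Pred (Fin m) 0ℓ} (P? : Decidable P) (K? : Decidable K) (I? : Decidable I) →
                          (∀ {x} → P x → I (τ x)) →
                          (∀ {x y} → P x → P y → τ x ≡ τ y → K (x + y)) →
                          card P? ≤ card K? * card I?
    card-≤-kernel*image {P} {K} {I} P? K? I? τ-maps τ-kernel = card-≤-* P? K? I? φ φ-injective φ-maps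
      where
      preimage : Fin m → Fin m
      preimage y with any? (λ x → P? x ×-dec (τ x ≟ y))
      ... | yes (x , _) = x
      ... | no  _       = y

      preimage-spec : ∀ {x} → P x → P (preimage (τ x)) × τ (preimage (τ x)) ≡ τ x
      preimage-spec {x} Px with any? (λ x′ → P? x′ ×-dec (τ x′ ≟ τ x))
      ... | yes (_ , spec) = spec
      ... | no  ∄x         = ⊥-elim (∄x (x , Px , refl))

      φ : Fin m → Fin m × Fin m
      φ x = x + preimage (τ x) , τ x

      φ-injective : Injective _≡_ _≡_ φ
      φ-injective {x} {y} φx≡φy = +-cancelʳ (preimage (τ x)) x y
        (trans (cong proj₁ φx≡φy) (cong (λ t → y + preimage t) (sym (cong proj₂ φx≡φy))))

      φ-maps : ∀ {x} → P x → (K ⟨×⟩ I) (φ x)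
      φ-maps Px = let (Ps , τs≡τx) = preimage-spec Px in τ-kernel Px Ps (sym τs≡τx) , τ-maps Px

open Counting using (card; card-≐; card-universal; card-≤-kernel*image)

module _ where
  open Algebra.Properties.CommutativeMonoid.Sum ℕ.+-0-commutativeMonoid using (sum)

  sum-mono-≤ : ∀ {k} {f g : Fin k → ℕ} → (∀ i → f i ≤ g i) → sum f ≤ sum g
  sum-mono-≤ {zero}  f≤g = z≤n
  sum-mono-≤ {suc k} f≤g = ℕ.+-mono-≤ (f≤g zero) (sum-mono-≤ (f≤g ∘ suc))

  ≤-sum : ∀ {k} (f : Fin k → ℕ) i → f i ≤ sum f
  ≤-sum f zero    = ℕ.m≤m+n (f zero) _
  ≤-sum f (suc i) = ℕ.≤-trans (≤-sum (f ∘ suc) i) (ℕ.m≤n+m _ (f zero))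

  sum-const-1 : ∀ k → sum {k} (λ _ → 1) ≡ k
  sum-const-1 zero    = refl
  sum-const-1 (suc k) = cong suc (sum-const-1 k)

^-distribʳ-* : ∀ a b k → (a * b) ^ k ≡ a ^ k * b ^ k
^-distribʳ-* a b zero    = refl
^-distribʳ-* a b (suc k) = trans (cong (a * b *_) (^-distribʳ-* a b k))
  (solve 4 (λ a b x y → (a :* b) :* (x :* y) := (a :* x) :* (b :* y)) refl a b (a ^ k) (b ^ k))
  where open +-*-Solver

bound-doubling : ∀ {m f w f′ w′} e → m ≤ f ^ e * w → f ≤ f′ * f′ → w ≤ f′ * w′ → m ≤ f′ ^ (e + suc e) * w′
bound-doubling {m} {f} {w} {f′} {w′} e m≤fᵉw f≤f′² w≤f′w′ = begin
  m                             ≤⟨ m≤fᵉw ⟩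
  f ^ e * w                     ≤⟨ ℕ.*-mono-≤ (ℕ.^-monoˡ-≤ e f≤f′²) w≤f′w′ ⟩
  (f′ * f′) ^ e * (f′ * w′)     ≡⟨ cong (_* (f′ * w′)) (^-distribʳ-* f′ f′ e) ⟩
  f′ ^ e * f′ ^ e * (f′ * w′)   ≡⟨ solve 3 (λ x f w → (x :* x) :* (f :* w) := (x :* (f :* x)) :* w) refl (f′ ^ e) f′ w′ ⟩
  f′ ^ e * f′ ^ suc e * w′      ≡⟨ cong (_* w′) (ℕ.^-distribˡ-+-* f′ e (suc e)) ⟨
  f′ ^ (e + suc e) * w′         ∎
  where
  open ℕ.≤-Reasoning
  open +-*-Solver

2^m≤2^n⇒m≤n : ∀ {a b} → 2 ^ a ≤ 2 ^ b → a ≤ b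
2^m≤2^n⇒m≤n {a} {b} 2ᵃ≤2ᵇ = subst₂ _≤_ (⌊log₂[2^n]⌋≡n a) (⌊log₂[2^n]⌋≡n b) (⌊log₂⌋-mono-≤ 2ᵃ≤2ᵇ)

module FiniteAbelianGroup {n : ℕ} (G : FinAbGroup n) where

  open FinAbGroup G using (_∙_; ε; _⁻¹; isAbelianGroup)

  abelianGroup : AbelianGroup 0ℓ 0ℓ
  abelianGroup = record { isAbelianGroup = isAbelianGroup }

  open AbelianGroup abelianGroup using (assoc; identityʳ; commutativeMonoid; commutativeSemigroup; group)
  open Group group public using (_\\_)
  open Algebra.Properties.AbelianGroup abelianGroup
    using (\\-leftDividesˡ; \\-leftDividesʳ; identityˡ-unique; inverseʳ-unique; x≈z//y)
  open Algebra.Properties.CommutativeSemigroup commutativeSemigroup using (interchange; x∙yz≈y∙xz)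
  open Algebra.Properties.CommutativeMonoid.Mult commutativeMonoid
    using (×-homo-+; ×-distrib-+) renaming (_×_ to _×ᵍ_)

  translation : Fin n → Permutation′ n
  translation h = permutation (h ∙_) (h \\_) (\\-leftDividesˡ h) (\\-leftDividesʳ h)

  -- Translating by y permutes the factors of ∏_z z, which multiplies the product by yⁿ.
  n×ᵍy≡ε : ∀ y → n ×ᵍ y ≡ ε
  n×ᵍy≡ε y = identityˡ-unique (n ×ᵍ y) (sum id) (begin
    (n ×ᵍ y) ∙ sum id           ≡⟨ cong (_∙ sum id) (sum-replicate n) ⟨
    sum {n} (λ _ → y) ∙ sum id  ≡⟨ ∑-distrib-+ {n} (λ _ → y) id ⟨
    sum (λ z → y ∙ z)           ≡⟨ ∑-permute id (translation y) ⟨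
    sum id                      ∎)
    where
    open ≡-Reasoning
    open Algebra.Properties.CommutativeMonoid.Sum commutativeMonoid using (sum; sum-replicate; ∑-distrib-+; ∑-permute)

  Subset : Set
  Subset = Fin n → Bool

  infix 4 _∈_ _∉_
  _∈_ _∉_ : Fin n → Subset → Set
  z ∈ H = H z ≡ true
  z ∉ H = H z ≡ false

  record IsSubmonoid (H : Subset) : Set where
    field
      ε∈ : ε ∈ H
      ∙∈ : ∀ {x y} → x ∈ H → y ∈ H → x ∙ y ∈ H

    ×∈ : ∀ k {x} → x ∈ H → k ×ᵍ x ∈ H
    ×∈ zero    x∈H = ε∈
    ×∈ (suc k) x∈H = ∙∈ x∈H (×∈ k x∈H)

    ⁻¹∈ : ∀ {x} → x ∈ H → x ⁻¹ ∈ H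
    ⁻¹∈ {x} x∈H = subst (_∈ H) (inverseʳ-unique x (pred n ×ᵍ x) x∙xⁿ⁻¹≡ε) (×∈ (pred n) x∈H)
      where
      instance _ = nonZeroIndex x
      x∙xⁿ⁻¹≡ε : x ∙ (pred n ×ᵍ x) ≡ ε
      x∙xⁿ⁻¹≡ε = trans (cong (_×ᵍ x) (ℕ.suc-pred n)) (n×ᵍy≡ε x)

    translate-∈ : ∀ {h} z → h ∈ H → H (h ∙ z) ≡ H z
    translate-∈ {h} z h∈H =
      ⇔→≡ (mk⇔ (λ hz∈H → subst (_∈ H) (\\-leftDividesʳ h z) (∙∈ (⁻¹∈ h∈H) hz∈H)) (∙∈ h∈H))

  trivial : Subset
  trivial z = does (z ≟ ε)

  ∈-trivial⁻ : ∀ {z} → z ∈ trivial → z ≡ ε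
  ∈-trivial⁻ {z} z∈trivial with z ≟ ε
  ... | yes z≡ε = z≡ε

  trivial-isSubmonoid : IsSubmonoid trivial
  trivial-isSubmonoid = record
    { ε∈ = dec-true (ε ≟ ε) refl
    ; ∙∈ = λ x∈trivial y∈trivial → dec-true (_ ≟ ε)
             (subst₂ (λ x y → x ∙ y ≡ ε) (sym (∈-trivial⁻ x∈trivial)) (sym (∈-trivial⁻ y∈trivial)) (identityʳ ε))
    }

  adjoin : Subset → Fin n → Subset
  adjoin H g z = H z ∨ H (g \\ z)

  module _ {H : Subset} {g : Fin n} where

    ∈-adjoin⁺ˡ : ∀ {z} → z ∈ H → z ∈ adjoin H g
    ∈-adjoin⁺ˡ {z} z∈H = cong (_∨ H (g \\ z)) z∈H

    ∈-adjoin⁺ʳ : ∀ {z} → g \\ z ∈ H → z ∈ adjoin H g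
    ∈-adjoin⁺ʳ {z} g⁻¹z∈H = trans (cong (H z ∨_) g⁻¹z∈H) (∨-zeroʳ (H z))

    ∈-adjoin⁻ : ∀ {z} → z ∈ adjoin H g → z ∈ H ⊎ g \\ z ∈ H
    ∈-adjoin⁻ {z} z∈H∪gH with H z
    ... | true  = inj₁ refl
    ... | false = inj₂ z∈H∪gH

    module _ (H-submonoid : IsSubmonoid H) where
      open IsSubmonoid H-submonoid

      adjoin-disjoint : g ∉ H → ∀ {z} → z ∈ H → g \\ z ∈ H → ⊥
      adjoin-disjoint g∉H {z} z∈H g⁻¹z∈H = contradiction (trans (sym g∈H) g∉H) λ ()
        where
        g∈H : g ∈ H
        g∈H = subst (_∈ H) (sym (x≈z//y g (g \\ z) z (\\-leftDividesˡ g z))) (∙∈ z∈H (⁻¹∈ g⁻¹z∈H))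

      adjoin-isSubmonoid : g ∙ g ∈ H → IsSubmonoid (adjoin H g)
      adjoin-isSubmonoid g²∈H = record { ε∈ = ∈-adjoin⁺ˡ ε∈ ; ∙∈ = ∙∈′ }
        where
        ∙∈′ : ∀ {x y} → x ∈ adjoin H g → y ∈ adjoin H g → x ∙ y ∈ adjoin H g
        ∙∈′ {x} {y} x∈H∪gH y∈H∪gH with ∈-adjoin⁻ x∈H∪gH | ∈-adjoin⁻ y∈H∪gH
        ... | inj₁ x∈H     | inj₁ y∈H     = ∈-adjoin⁺ˡ (∙∈ x∈H y∈H)
        ... | inj₁ x∈H     | inj₂ g⁻¹y∈H = ∈-adjoin⁺ʳ (subst (_∈ H) (x∙yz≈y∙xz x (g ⁻¹) y) (∙∈ x∈H g⁻¹y∈H))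
        ... | inj₂ g⁻¹x∈H | inj₁ y∈H     = ∈-adjoin⁺ʳ (subst (_∈ H) (assoc (g ⁻¹) x y) (∙∈ g⁻¹x∈H y∈H))
        ... | inj₂ g⁻¹x∈H | inj₂ g⁻¹y∈H = ∈-adjoin⁺ˡ (subst (_∈ H) g²·g⁻¹x·g⁻¹y≡xy (∙∈ g²∈H (∙∈ g⁻¹x∈H g⁻¹y∈H)))
          where
          g²·g⁻¹x·g⁻¹y≡xy : (g ∙ g) ∙ ((g \\ x) ∙ (g \\ y)) ≡ x ∙ y
          g²·g⁻¹x·g⁻¹y≡xy = trans (interchange g g (g \\ x) (g \\ y))
                                  (cong₂ _∙_ (\\-leftDividesˡ g x) (\\-leftDividesˡ g y))

  square-until-∈ : ∀ {H} j {y} → y ∉ H → (2 ^ j) ×ᵍ y ∈ H → ∃[ g ] g ∉ H × g ∙ g ∈ H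
  square-until-∈ {H} zero    {y} y∉H y∈H = contradiction (trans (sym (subst (_∈ H) (identityʳ y) y∈H)) y∉H) λ ()
  square-until-∈ {H} (suc j) {y} y∉H y²ʲ⁺¹∈H with H (y ∙ y) in y²∈H
  ... | true  = y , y∉H , y²∈H
  ... | false = square-until-∈ j y²∈H (subst (_∈ H) (sym powers-of-square) y²ʲ⁺¹∈H)
    where
    open ≡-Reasoning
    powers-of-square : (2 ^ j) ×ᵍ (y ∙ y) ≡ (2 ^ suc j) ×ᵍ y
    powers-of-square = begin
      (2 ^ j) ×ᵍ (y ∙ y)              ≡⟨ ×-distrib-+ y y (2 ^ j) ⟩
      ((2 ^ j) ×ᵍ y) ∙ ((2 ^ j) ×ᵍ y) ≡⟨ ×-homo-+ y (2 ^ j) (2 ^ j) ⟨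
      (2 ^ j + 2 ^ j) ×ᵍ y            ≡⟨ cong (λ t → (2 ^ j + t) ×ᵍ y) (ℕ.+-identityʳ (2 ^ j)) ⟨
      (2 ^ suc j) ×ᵍ y                ∎

  proper⇒∃-∉-square-∈ : ∀ {k} → n ≡ 2 ^ k → ∀ {H} → IsSubmonoid H → ¬ (∀ z → z ∈ H) →
                         ∃[ g ] g ∉ H × g ∙ g ∈ H
  proper⇒∃-∉-square-∈ {k} n≡2ᵏ {H} H-submonoid proper with y , y≢true ← ¬∀⟶∃¬ n _ (λ z → H z ≟ᵇ true) proper =
    square-until-∈ k (¬-not y≢true)
      (subst (_∈ H) (trans (sym (n×ᵍy≡ε y)) (cong (_×ᵍ y) n≡2ᵏ)) (IsSubmonoid.ε∈ H-submonoid))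

  module SumOver {A : Set} {_⊕_ : Op₂ A} {0# : A} (isCM : IsCommutativeMonoid _≡_ _⊕_ 0#) where
    open IsCommutativeMonoid isCM using () renaming (identityˡ to ⊕-identityˡ; identityʳ to ⊕-identityʳ)
    commutativeMonoidᴬ : CommutativeMonoid 0ℓ 0ℓ
    commutativeMonoidᴬ = record { isCommutativeMonoid = isCM }

    open Algebra.Properties.CommutativeMonoid.Sum commutativeMonoidᴬ
      using (sum; sum-cong-≗; ∑-distrib-+; ∑-permute; sum-replicate-zero)
    open ≡-Reasoning

    sumOver : Subset → (Fin n → A) → A
    sumOver H f = sum (λ z → if H z then f z else 0#)

    syntax sumOver H (λ z → x) = ∑[ z ∈ H ] x

    sumOver-cong : ∀ H {f f′ : Fin n → A} → (∀ z → f z ≡ f′ z) → sumOver H f ≡ sumOver H f′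
    sumOver-cong H f≗f′ = sum-cong-≗ (λ z → cong (if H z then_else 0#) (f≗f′ z))

    sumOver-distrib : ∀ H (f f′ : Fin n → A) → ∑[ z ∈ H ] (f z ⊕ f′ z) ≡ sumOver H f ⊕ sumOver H f′
    sumOver-distrib H f f′ = trans (sum-cong-≗ {n} if-distrib) (∑-distrib-+ {n} _ _)
      where
      if-distrib : ∀ z → (if H z then f z ⊕ f′ z else 0#) ≡ (if H z then f z else 0#) ⊕ (if H z then f′ z else 0#)
      if-distrib z with H z
      ... | true  = refl
      ... | false = sym (⊕-identityˡ 0#)

    module _ (φ : A → A) (φ-0 : φ 0# ≡ 0#) (φ-⊕ : ∀ a b → φ (a ⊕ b) ≡ φ a ⊕ φ b) where

      sum-homo : ∀ {k} (f : Fin k → A) → φ (sum f) ≡ sum (φ ∘ f)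
      sum-homo {zero}  f = φ-0
      sum-homo {suc k} f = trans (φ-⊕ _ _) (cong (φ (f zero) ⊕_) (sum-homo (f ∘ suc)))

      sumOver-homo : ∀ H f → φ (sumOver H f) ≡ sumOver H (φ ∘ f)
      sumOver-homo H f = trans (sum-homo {n} _) (sum-cong-≗ φ-if)
        where
        φ-if : ∀ z → φ (if H z then f z else 0#) ≡ (if H z then φ (f z) else 0#)
        φ-if z with H z
        ... | true  = refl
        ... | false = φ-0

    sumOver-whole : ∀ {H} → (∀ z → z ∈ H) → ∀ f → sumOver H f ≡ sum f
    sumOver-whole whole f = sum-cong-≗ (λ z → cong (if_then f z else 0#) (whole z))

    foldr-tabulate : ∀ {X : Set} (f : X → A) {k} (t : Fin k → X) →
                     foldr (λ x acc → f x ⊕ acc) 0# (tabulate t) ≡ sum (f ∘ t)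
    foldr-tabulate f {zero}  t = refl
    foldr-tabulate f {suc k} t = cong (f (t zero) ⊕_) (foldr-tabulate f (t ∘ suc))

    sum-≡-single : ∀ {k} (f : Fin k → A) i → (∀ j → j ≢ i → f j ≡ 0#) → sum f ≡ f i
    sum-≡-single {suc k} f zero    f≡0 = trans (cong (f zero ⊕_) rest≡0) (⊕-identityʳ (f zero))
      where
      rest≡0 : sum (f ∘ suc) ≡ 0#
      rest≡0 = trans (sum-cong-≗ (λ j → f≡0 (suc j) λ ())) (sum-replicate-zero k)
    sum-≡-single f (suc i) f≡0 = trans
      (cong₂ _⊕_ (f≡0 zero λ ()) (sum-≡-single (f ∘ suc) i (λ j j≢i → f≡0 (suc j) (j≢i ∘ suc-injective))))
      (⊕-identityˡ (f (suc i)))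

    sumOver-trivial : ∀ f → sumOver trivial f ≡ f ε
    sumOver-trivial f =
      trans (sum-≡-single _ ε outside≡0) (cong (if_then f ε else 0#) (dec-true (ε ≟ ε) refl))
      where
      outside≡0 : ∀ z → z ≢ ε → (if trivial z then f z else 0#) ≡ 0#
      outside≡0 z z≢ε = cong (if_then f z else 0#) (dec-false (z ≟ ε) z≢ε)

    module _ {H : Subset} (H-submonoid : IsSubmonoid H) where

      sumOver-translate : ∀ {h} → h ∈ H → ∀ f → ∑[ z ∈ H ] f (h ∙ z) ≡ sumOver H f
      sumOver-translate {h} h∈H f = sym (begin
        sumOver H f                                       ≡⟨ ∑-permute _ (translation h) ⟩
        sum (λ z → if H (h ∙ z) then f (h ∙ z) else 0#)   ≡⟨ sum-cong-≗ (λ z → cong (if_then f (h ∙ z) else 0#)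
                                                               (IsSubmonoid.translate-∈ H-submonoid z h∈H)) ⟩
        ∑[ z ∈ H ] f (h ∙ z)                              ∎)

      sumOver-adjoin : ∀ {g} → g ∉ H → ∀ f → sumOver (adjoin H g) f ≡ sumOver H f ⊕ (∑[ z ∈ H ] f (g ∙ z))
      sumOver-adjoin {g} g∉H f = begin
        sumOver (adjoin H g) f
          ≡⟨ sum-cong-≗ {n} split ⟩
        sum (λ z → (if H z then f z else 0#) ⊕ (if H (g \\ z) then f z else 0#))
          ≡⟨ ∑-distrib-+ {n} _ _ ⟩
        sumOver H f ⊕ sum (λ z → if H (g \\ z) then f z else 0#)
          ≡⟨ cong (sumOver H f ⊕_) (∑-permute _ (translation g)) ⟩
        sumOver H f ⊕ sum (λ z → if H (g \\ (g ∙ z)) then f (g ∙ z) else 0#)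
          ≡⟨ cong (sumOver H f ⊕_) (sum-cong-≗ (λ z → cong (λ w → if H w then f (g ∙ z) else 0#) (\\-leftDividesʳ g z))) ⟩
        sumOver H f ⊕ (∑[ z ∈ H ] f (g ∙ z))
          ∎
        where
        split : ∀ z → (if adjoin H g z then f z else 0#) ≡ (if H z then f z else 0#) ⊕ (if H (g \\ z) then f z else 0#)
        split z with H z in z∈H | H (g \\ z) in g⁻¹z∈H
        ... | true  | true  = ⊥-elim (adjoin-disjoint H-submonoid g∉H z∈H g⁻¹z∈H)
        ... | true  | false = sym (⊕-identityʳ (f z))
        ... | false | true  = sym (⊕-identityˡ (f z))
        ... | false | false = sym (⊕-identityˡ 0#)

  private
    module ℕ-Sum = SumOver ℕ.+-0-isCommutativeMonoid

  order : Subset → ℕ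
  order H = ℕ-Sum.sumOver H (λ _ → 1)

  order-trivial : order trivial ≡ 1
  order-trivial = ℕ-Sum.sumOver-trivial (λ _ → 1)

  order-adjoin : ∀ {H} → IsSubmonoid H → ∀ {g} → g ∉ H → order (adjoin H g) ≡ order H + order H
  order-adjoin H-submonoid g∉H = ℕ-Sum.sumOver-adjoin H-submonoid g∉H (λ _ → 1)

  order-whole : ∀ {H} → (∀ z → z ∈ H) → order H ≡ n
  order-whole whole = trans (ℕ-Sum.sumOver-whole whole (λ _ → 1)) (sum-const-1 n)

  order-≤ : ∀ H → order H ≤ n
  order-≤ H = ℕ.≤-trans (sum-mono-≤ indicator-≤) (ℕ.≤-reflexive (sum-const-1 n))
    where
    indicator-≤ : ∀ z → (if H z then 1 else 0) ≤ 1
    indicator-≤ z with H z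
    ... | true  = ℕ.≤-refl
    ... | false = z≤n

  order-pos : ∀ {H} → IsSubmonoid H → 1 ≤ order H
  order-pos {H} H-submonoid =
    subst (λ b → (if b then 1 else 0) ≤ order H) (IsSubmonoid.ε∈ H-submonoid) (≤-sum _ ε)

  module _ {k} (n≡2ᵏ : n ≡ 2 ^ k) (P : Subset → Set) (P-trivial : P trivial)
           (P-adjoin : ∀ {H g} → IsSubmonoid H → g ∉ H → g ∙ g ∈ H → P H → P (adjoin H g)) where

    submonoid-induction : ∃[ H ] (∀ z → z ∈ H) × P H
    submonoid-induction = grow k trivial-isSubmonoid index-trivial P-trivial
      where
      index-trivial : order trivial * 2 ^ k ≡ n
      index-trivial = trans (cong (_* 2 ^ k) order-trivial) (trans (ℕ.*-identityˡ (2 ^ k)) (sym n≡2ᵏ))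

      grow : ∀ i {H} → IsSubmonoid H → order H * 2 ^ i ≡ n → P H → ∃[ H ] (∀ z → z ∈ H) × P H
      grow i {H} H-submonoid index PH with all? (λ z → H z ≟ᵇ true)
      ... | yes whole = H , whole , PH
      ... | no proper with i | index | proper⇒∃-∉-square-∈ {k} n≡2ᵏ H-submonoid proper
      ...   | zero  | index | g , g∉H , g²∈H = contradiction (order-≤ (adjoin H g)) (ℕ.<⇒≱ n<|H∪gH|)
        where
        n<|H∪gH| : n < order (adjoin H g)
        n<|H∪gH| = subst₂ _<_ (trans (sym (ℕ.*-identityʳ (order H))) index) (sym (order-adjoin H-submonoid g∉H))
                              (ℕ.m<m+n (order H) (order-pos H-submonoid))
      ...   | suc i | index | g , g∉H , g²∈H =
        grow i (adjoin-isSubmonoid H-submonoid g²∈H) index′ (P-adjoin H-submonoid g∉H g²∈H PH)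
        where
        index′ : order (adjoin H g) * 2 ^ i ≡ n
        index′ = trans (cong (_* 2 ^ i) (order-adjoin H-submonoid g∉H)) (trans (double (order H) (2 ^ i)) index)
          where
          double : ∀ a b → (a + a) * b ≡ a * (2 * b)
          double = solve 2 (λ a b → (a :+ a) :* b := a :* (con 2 :* b)) refl
            where open +-*-Solver

module F2GModule {n : ℕ} {G : FinAbGroup n} {m : ℕ} (M : FinF2GModule G m) where

  open FinAbGroup G using (_∙_; ε)
  open FiniteAbelianGroup G
  open AbelianGroup abelianGroup using () renaming (comm to ∙-comm)
  open Algebra.Properties.AbelianGroup abelianGroup using (\\-leftDividesˡ)
  open FinF2GModule M using (act; act-ε; act-∙; act-+; char2; norm; cardFixed; cardNormImage)
    renaming (_+_ to _⊕_; 0# to 0ᴹ)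

  abelianGroupᴹ : AbelianGroup 0ℓ 0ℓ
  abelianGroupᴹ = record { isAbelianGroup = FinF2GModule.isAbelianGroup M }

  open AbelianGroup abelianGroupᴹ using (isCommutativeMonoid; commutativeSemigroup; identityˡ; comm)
  open Algebra.Properties.AbelianGroup abelianGroupᴹ using (identityʳ-unique; ∙-cancelʳ)
  open Algebra.Properties.CommutativeSemigroup commutativeSemigroup using (interchange)
  open SumOver isCommutativeMonoid

  act-0 : ∀ h → act h 0ᴹ ≡ 0ᴹ
  act-0 h = identityʳ-unique (act h 0ᴹ) (act h 0ᴹ) (trans (sym (act-+ h 0ᴹ 0ᴹ)) (cong (act h) (identityˡ 0ᴹ)))

  ⊕≡0⇒≡ : ∀ x y → x ⊕ y ≡ 0ᴹ → x ≡ y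
  ⊕≡0⇒≡ x y x⊕y≡0 = ∙-cancelʳ y x y (trans x⊕y≡0 (sym (char2 y)))

  act-sumOver : ∀ h H f → act h (sumOver H f) ≡ ∑[ z ∈ H ] act h (f z)
  act-sumOver h = sumOver-homo (act h) (act-0 h) (act-+ h)

  FixedBy : Subset → Pred (Fin m) 0ℓ
  FixedBy H x = ∀ z → z ∈ H → act z x ≡ x

  fixedBy? : ∀ H → Decidable (FixedBy H)
  fixedBy? H x = all? (λ z → (H z ≟ᵇ true) →-dec (act z x ≟ x))

  normOver : Subset → Fin m → Fin m
  normOver H x = ∑[ z ∈ H ] act z x

  NormImage : Subset → Pred (Fin m) 0ℓ
  NormImage H y = ∃[ x ] normOver H x ≡ y

  normImage? : ∀ H → Decidable (NormImage H)
  normImage? H y = any? (λ x → normOver H x ≟ y)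

  module _ {H : Subset} where

    FixedBy-⊕ : ∀ {x y} → FixedBy H x → FixedBy H y → FixedBy H (x ⊕ y)
    FixedBy-⊕ x-fixed y-fixed z z∈H = trans (act-+ z _ _) (cong₂ _⊕_ (x-fixed z z∈H) (y-fixed z z∈H))

    normOver-⊕ : ∀ x y → normOver H (x ⊕ y) ≡ normOver H x ⊕ normOver H y
    normOver-⊕ x y = trans (sumOver-cong H (λ z → act-+ z x y)) (sumOver-distrib H _ _)

    NormImage-⊕ : ∀ {x y} → NormImage H x → NormImage H y → NormImage H (x ⊕ y)
    NormImage-⊕ (u , refl) (v , refl) = u ⊕ v , normOver-⊕ u v

    normOver-fixed : IsSubmonoid H → ∀ x → FixedBy H (normOver H x)
    normOver-fixed H-submonoid x h h∈H = begin
      act h (normOver H x)        ≡⟨ act-sumOver h H (λ z → act z x) ⟩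
      ∑[ z ∈ H ] act h (act z x)  ≡⟨ sumOver-cong H (λ z → act-∙ h z x) ⟨
      ∑[ z ∈ H ] act (h ∙ z) x    ≡⟨ sumOver-translate H-submonoid h∈H (λ z → act z x) ⟩
      normOver H x                ∎
      where open ≡-Reasoning

    NormImage⊆FixedBy : IsSubmonoid H → ∀ {y} → NormImage H y → FixedBy H y
    NormImage⊆FixedBy H-submonoid (x , refl) = normOver-fixed H-submonoid x

  module _ {H : Subset} {g : Fin n} where

    τ : Fin m → Fin m
    τ y = y ⊕ act g y

    FixedBy-adjoin : ∀ {y} → FixedBy H y → act g y ≡ y → FixedBy (adjoin H g) y
    FixedBy-adjoin {y} y-fixed gy≡y z z∈H∪gH with ∈-adjoin⁻ {H} {g} z∈H∪gH
    ... | inj₁ z∈H    = y-fixed z z∈H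
    ... | inj₂ g⁻¹z∈H = begin
      act z y                   ≡⟨ cong (λ w → act w y) (\\-leftDividesˡ g z) ⟨
      act (g ∙ (g \\ z)) y      ≡⟨ act-∙ g (g \\ z) y ⟩
      act g (act (g \\ z) y)    ≡⟨ cong (act g) (y-fixed (g \\ z) g⁻¹z∈H) ⟩
      act g y                   ≡⟨ gy≡y ⟩
      y                         ∎
      where open ≡-Reasoning

    τ-fixed : g ∙ g ∈ H → ∀ {y} → FixedBy H y → FixedBy (adjoin H g) (τ y)
    τ-fixed g²∈H {y} y-fixed = FixedBy-adjoin τy-fixed gτy≡τy
      where
      open ≡-Reasoning
      τy-fixed : FixedBy H (τ y)
      τy-fixed h h∈H = begin
        act h (y ⊕ act g y)           ≡⟨ act-+ h y (act g y) ⟩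
        act h y ⊕ act h (act g y)     ≡⟨ cong₂ _⊕_ (y-fixed h h∈H) (sym (act-∙ h g y)) ⟩
        y ⊕ act (h ∙ g) y             ≡⟨ cong (λ w → y ⊕ act w y) (∙-comm h g) ⟩
        y ⊕ act (g ∙ h) y             ≡⟨ cong (y ⊕_) (trans (act-∙ g h y) (cong (act g) (y-fixed h h∈H))) ⟩
        y ⊕ act g y                   ∎
      gτy≡τy : act g (τ y) ≡ τ y
      gτy≡τy = begin
        act g (y ⊕ act g y)           ≡⟨ act-+ g y (act g y) ⟩
        act g y ⊕ act g (act g y)     ≡⟨ cong (act g y ⊕_) (trans (sym (act-∙ g g y)) (y-fixed (g ∙ g) g²∈H)) ⟩
        act g y ⊕ y                   ≡⟨ comm (act g y) y ⟩
        y ⊕ act g y                   ∎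

    τ-kernel : ∀ {x y} → τ x ≡ τ y → act g (x ⊕ y) ≡ x ⊕ y
    τ-kernel {x} {y} τx≡τy = sym (⊕≡0⇒≡ (x ⊕ y) (act g (x ⊕ y)) (begin
      (x ⊕ y) ⊕ act g (x ⊕ y)       ≡⟨ cong ((x ⊕ y) ⊕_) (act-+ g x y) ⟩
      (x ⊕ y) ⊕ (act g x ⊕ act g y) ≡⟨ interchange x y (act g x) (act g y) ⟩
      τ x ⊕ τ y                     ≡⟨ cong (_⊕ τ y) τx≡τy ⟩
      τ y ⊕ τ y                     ≡⟨ char2 (τ y) ⟩
      0ᴹ                            ∎))
      where open ≡-Reasoning

    normOver-adjoin : IsSubmonoid H → g ∉ H → ∀ x → normOver (adjoin H g) x ≡ τ (normOver H x)
    normOver-adjoin H-submonoid g∉H x = begin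
      normOver (adjoin H g) x                       ≡⟨ sumOver-adjoin H-submonoid g∉H (λ z → act z x) ⟩
      normOver H x ⊕ (∑[ z ∈ H ] act (g ∙ z) x)    ≡⟨ cong (normOver H x ⊕_) (sumOver-cong H (λ z → act-∙ g z x)) ⟩
      normOver H x ⊕ (∑[ z ∈ H ] act g (act z x))  ≡⟨ cong (normOver H x ⊕_) (act-sumOver g H (λ z → act z x)) ⟨
      τ (normOver H x)                              ∎
      where open ≡-Reasoning

    card-fixedBy-adjoin : g ∙ g ∈ H → card (fixedBy? H) ≤ card (fixedBy? (adjoin H g)) * card (fixedBy? (adjoin H g))
    card-fixedBy-adjoin g²∈H = card-≤-kernel*image ∙-cancelʳ τ (fixedBy? H) (fixedBy? _) (fixedBy? _) (τ-fixed g²∈H)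
      (λ x-fixed y-fixed τx≡τy → FixedBy-adjoin (FixedBy-⊕ x-fixed y-fixed) (τ-kernel τx≡τy))

    card-normImage-adjoin : IsSubmonoid H → g ∉ H →
                            card (normImage? H) ≤ card (fixedBy? (adjoin H g)) * card (normImage? (adjoin H g))
    card-normImage-adjoin H-submonoid g∉H = card-≤-kernel*image ∙-cancelʳ τ (normImage? H) (fixedBy? _) (normImage? _)
      (λ { (x , refl) → x , normOver-adjoin H-submonoid g∉H x })
      (λ x∈NH y∈NH τx≡τy → FixedBy-adjoin (NormImage⊆FixedBy H-submonoid (NormImage-⊕ x∈NH y∈NH)) (τ-kernel τx≡τy))

  Bound : Subset → Set
  Bound H = m ≤ card (fixedBy? H) ^ (order H ∸ 1) * card (normImage? H)

  Bound-trivial : Bound trivial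
  Bound-trivial rewrite order-trivial =
    ℕ.≤-reflexive (sym (trans (ℕ.+-identityʳ _) (card-universal (normImage? trivial) (λ x → x , normOver-trivial x))))
    where
    normOver-trivial : ∀ x → normOver trivial x ≡ x
    normOver-trivial x = trans (sumOver-trivial (λ z → act z x)) (act-ε x)

  Bound-adjoin : ∀ {H g} → IsSubmonoid H → g ∉ H → g ∙ g ∈ H → Bound H → Bound (adjoin H g)
  Bound-adjoin {H} {g} H-submonoid g∉H g²∈H bound rewrite order-adjoin H-submonoid g∉H
    with order H | order-pos H-submonoid
  ... | suc e | _ = bound-doubling e bound (card-fixedBy-adjoin g²∈H) (card-normImage-adjoin H-submonoid g∉H)

  module _ {H : Subset} (whole : ∀ z → z ∈ H) where

    normOver-whole : ∀ x → normOver H x ≡ norm x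
    normOver-whole x = trans (sumOver-whole whole (λ z → act z x)) (sym (foldr-tabulate (λ z → act z x) id))

    card-fixedBy-whole : card (fixedBy? H) ≡ cardFixed
    card-fixedBy-whole = card-≐ (fixedBy? H) _ ((λ x-fixed z → x-fixed z (whole z)) , (λ x-fixed z _ → x-fixed z))

    card-normImage-whole : card (normImage? H) ≡ cardNormImage
    card-normImage-whole = card-≐ (normImage? H) _
      ((λ (x , Nx≡y) → x , trans (sym (normOver-whole x)) Nx≡y) , (λ (x , Nx≡y) → x , trans (normOver-whole x) Nx≡y))

    Bound-whole : Bound H → m ≤ cardFixed ^ (n ∸ 1) * cardNormImage
    Bound-whole bound rewrite order-whole whole | card-fixedBy-whole | card-normImage-whole = bound

  card-bound : ∀ {k} → n ≡ 2 ^ k → m ≤ cardFixed ^ (n ∸ 1) * cardNormImage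
  card-bound {k} n≡2ᵏ with _ , whole , bound ← submonoid-induction {k} n≡2ᵏ Bound Bound-trivial Bound-adjoin =
    Bound-whole whole bound

lemmaA1 : (r : ℕ) → (G : FinAbGroup (2 ^ suc r)) → (m : ℕ) → (M : FinF2GModule G m)
          → (d d₁ d₂ : ℕ)
          → 2 ^ d ≡ m
          → 2 ^ d₁ ≡ FinF2GModule.cardFixed M
          → 2 ^ d₂ ≡ FinF2GModule.cardNormImage M
          → d ≤ (2 ^ suc r ∸ 1) * d₁ + d₂
lemmaA1 r G m M d d₁ d₂ 2ᵈ≡m 2ᵈ¹≡|Mᴳ| 2ᵈ²≡|NM| = 2^m≤2^n⇒m≤n (begin
  2 ^ d                                         ≡⟨ 2ᵈ≡m ⟩
  m                                             ≤⟨ F2GModule.card-bound M {suc r} refl ⟩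
  cardFixed ^ e * cardNormImage                 ≡⟨ cong₂ (λ a b → a ^ e * b) 2ᵈ¹≡|Mᴳ| 2ᵈ²≡|NM| ⟨
  (2 ^ d₁) ^ e * 2 ^ d₂                         ≡⟨ cong (_* 2 ^ d₂) (trans (ℕ.^-*-assoc 2 d₁ e) (cong (2 ^_) (ℕ.*-comm d₁ e))) ⟩
  2 ^ (e * d₁) * 2 ^ d₂                         ≡⟨ ℕ.^-distribˡ-+-* 2 (e * d₁) d₂ ⟨
  2 ^ (e * d₁ + d₂)                             ∎)
  where
  open ℕ.≤-Reasoning
  open FinF2GModule M using (cardFixed; cardNormImage)
  e : ℕ
  e = 2 ^ suc r ∸ 1
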